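{- Let $f:\mathbb{F}_2^n\to\mathbb{F}_2^n$ be a conjunctive Boolean network whose dependency graph is strongly connected with loop number $c$. If $c=1$, then $f$ has exactly the two fixed points $(0,\dots,0)$ and $(1,\dots,1)$ and no other limit cycles of any length. If $c>1$ and $m$ is a divisor of $c$ with prime factorization $m=\prod_{i=1}^r p_i^{k_i}$ ($p_i$ distinct primes, $k_i\ge1$), then the number $|A(m)|$ of periodic points of period exactly $m$ is $$|A(m)|=\sum_{i_1=0}^1\cdots\sum_{i_r=0}^1(-1)^{i_1+\cdots+i_r}\,2^{p_1^{k_1-i_1}p_2^{k_2-i_2}\cdots p_r^{k_r-i_r}}.$$
   Context: $\mathbb{F}_2=\{0,1\}$. A conjunctive Boolean network is a map $f=(f_1,\dots,f_n):\mathbb{F}_2^n\to\mathbb{F}_2^n$ where each $f_i$ is a product (AND) of a nonempty set of variables. Its dependency graph has vertices $1,\dots,n$ and an edge $i\to j$ iff $x_i$ appears in $f_j$. The loop number of a strongly connected graph (with at least one edge) is the gcd of the lengths of its simple directed cycles. A point $\mathbf{u}$ has period $t$ if $t$ is least positive with $f^t(\mathbf{u})=\mathbf{u}$; a limit cycle of length $t$ is the orbit of such a point; a fixed point is a point of period 1. -}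

module Defs where

open import Data.Nat using (ℕ; zero; suc; _+_; _*_; _∸_; _^_; _≤_; _<_)
open import Data.Nat.Divisibility using (_∣_)
open import Data.Bool using (Bool; true; false; _∧_)
open import Data.Fin using (Fin; zero; suc; inject₁; fromℕ)
open import Data.Fin.Subset using (Subset; inside; outside; _∈_; Nonempty)
open import Data.Vec using (Vec; []; _∷_; tabulate; lookup; replicate)
open import Data.List using (List; []; _∷_; allFin; foldr; map; length; _++_)
open import Data.List.Relation.Unary.Unique.Propositional using (Unique)
import Data.List.Membership.Propositional as LM
open import Data.Integer using (ℤ; +_; -_) renaming (_+_ to _+ℤ_; _*_ to _*ℤ_)
open import Data.Product using (Σ; ∃; _×_; _,_)
open import Function using (Injective; _⇔_)
open import Relation.Binary.PropositionalEquality using (_≡_)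
open import Relation.Binary.Construct.Closure.ReflexiveTransitive using (Star)

-- A network on n variables is given by, for each coordinate j, the set
-- deps j ⊆ {0..n-1} of variables occurring in f_j (required nonempty).

Network : ℕ → Set
Network n = Fin n → Subset n

IsConjunctive : ∀ {n} → Network n → Set
IsConjunctive {n} deps = ∀ (j : Fin n) → Nonempty (deps j)

conj : ∀ {n} → Subset n → Vec Bool n → Bool
conj {n} S u = foldr _∧_ true (map term (allFin n))
  where
    term : Fin n → Bool
    term i with lookup S i
    ... | inside  = lookup u i
    ... | outside = true

apply : ∀ {n} → Network n → Vec Bool n → Vec Bool n
apply deps u = tabulate (λ j → conj (deps j) u)

iter : ∀ {n} → Network n → ℕ → Vec Bool n → Vec Bool n
iter deps zero    u = u
iter deps (suc t) u = apply deps (iter deps t u)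

HasPeriod : ∀ {n} → Network n → Vec Bool n → ℕ → Set
HasPeriod deps u t =
  (1 ≤ t) × (iter deps t u ≡ u) × (∀ s → 1 ≤ s → s < t → ¬' (iter deps s u ≡ u))
  where
    open import Relation.Nullary using () renaming (¬_ to ¬'_)

IsFixedPoint : ∀ {n} → Network n → Vec Bool n → Set
IsFixedPoint deps u = apply deps u ≡ u

Edge : ∀ {n} → Network n → Fin n → Fin n → Set
Edge deps i j = i ∈ deps j

Reachable : ∀ {n} → Network n → Fin n → Fin n → Set
Reachable deps = Star (Edge deps)

StronglyConnected : ∀ {n} → Network n → Set
StronglyConnected {n} deps =
  (∀ (i j : Fin n) → Reachable deps i j) × (∃ λ i → ∃ λ j → Edge deps i j)

record SimpleCycle {n} (deps : Network n) (len : ℕ) : Set where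
  field
    l      : ℕ
    len≡   : len ≡ suc l
    v      : Fin (suc l) → Fin n
    simple : Injective _≡_ _≡_ v
    step   : ∀ (k : Fin l) → Edge deps (v (inject₁ k)) (v (suc k))
    close  : Edge deps (v (fromℕ l)) (v zero)

IsLoopNumber : ∀ {n} → Network n → ℕ → Set
IsLoopNumber deps c =
  (∀ len → SimpleCycle deps len → c ∣ len) ×
  (∀ d → (∀ len → SimpleCycle deps len → d ∣ len) → d ∣ c)

HasCardinality : ∀ {A : Set} → (A → Set) → ℕ → Set
HasCardinality {A} P N =
  Σ (List A) λ L → Unique L × (∀ a → (a LM.∈ L) ⇔ P a) × (length L ≡ N)

sumFin : ∀ r → (Fin r → ℕ) → ℕ
sumFin zero    g = 0
sumFin (suc r) g = g zero + sumFin r (λ i → g (suc i))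

prodFin : ∀ r → (Fin r → ℕ) → ℕ
prodFin zero    g = 1
prodFin (suc r) g = g zero * prodFin r (λ i → g (suc i))

-- index tuples (i_1,…,i_r) ∈ {0,1}^r are maps Fin r → Fin 2
nestedSum01 : ∀ r → ((Fin r → Fin 2) → ℤ) → ℤ
nestedSum01 zero    g = g (λ ())
nestedSum01 (suc r) g =
  nestedSum01 r (λ is → g (cons zero is)) +ℤ nestedSum01 r (λ is → g (cons (suc zero) is))
  where
    cons : Fin 2 → (Fin r → Fin 2) → Fin (suc r) → Fin 2
    cons b is zero    = b
    cons b is (suc i) = is i

toN2 : Fin 2 → ℕ
toN2 zero       = 0
toN2 (suc zero) = 1

signPow : ℕ → ℤ
signPow zero    = + 1
signPow (suc e) = - signPow e

periodFormula : ∀ r → (Fin r → ℕ) → (Fin r → ℕ) → ℤ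
periodFormula r p k =
  nestedSum01 r (λ is →
    signPow (sumFin r (λ j → toN2 (is j)))
    *ℤ (+ (2 ^ prodFin r (λ j → p j ^ (k j ∸ toN2 (is j))))))

-- For a conjunctive network, (f^L u)ⱼ = 0 exactly when some walk of length L from a zero of u
-- ends at j. Cutting a closed walk at a repeated vertex splits it into shorter closed walks, so
-- every closed walk has length divisible by the loop number c. Fixing a root and letting the
-- level of j be the length of some walk from the root to j, every walk from i to j then has
-- length ≡ level j - level i (mod c). Hence for M ∣ c the state u is fixed by f^M iff it is
-- constant on the classes of level mod M, and f^M has exactly 2^M fixed points.
-- A point has period m = ∏ pⱼ^kⱼ iff it is fixed by f^m but by no f^(m/pⱼ); as f^a u = u and
-- f^b u = u give f^(gcd a b) u = u, inclusion-exclusion over the primes, one prime at a time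
-- with the exponents already dealt with kept as a factor B, gives the formula.
-- For c = 1 a descent through gcd's of cycle lengths (Bézout) gives, for every t, walks of
-- length divisible by t between any two vertices, so a zero of a point of period t spreads to
-- every vertex: periodic points are constant, hence the two fixed points.

module Submission where

open import Data.Bool using (Bool; true; false; if_then_else_)
import Data.Bool.Properties as Bool
open import Data.Bool.ListAction using (all)
open import Data.Fin using (Fin; zero; suc; toℕ; fromℕ; fromℕ<; inject₁)
import Data.Fin.Properties as Fin
open import Data.Fin.Properties using (toℕ-injective; toℕ<n; toℕ-fromℕ; toℕ-fromℕ<; toℕ-inject₁)
open import Data.Fin.Subset using (Subset; inside; _∈_)
open import Data.Integer using (ℤ; +_; -_; _⊖_) renaming (_+_ to _+ℤ_; _*_ to _*ℤ_; _-_ to _-ℤ_)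
import Data.Integer.Properties as ℤ
open import Data.List using (List; []; _∷_; map; _++_; length; filter; allFin)
open import Data.List.Membership.Propositional using () renaming (_∈_ to _∈ₗ_)
open import Data.List.Membership.Propositional.Properties
  using (∈-allFin; ∈-map⁺; ∈-map⁻; ∈-++⁺ˡ; ∈-++⁺ʳ; ∈-filter⁺; ∈-filter⁻)
open import Data.List.Membership.Propositional.Properties.WithK using (unique∧set⇒bag)
open import Data.List.Properties using (length-++; length-map; filter-≐)
open import Data.List.Relation.Binary.BagAndSetEquality using (∼bag⇒↭)
open import Data.List.Relation.Binary.Permutation.Propositional.Properties using (↭-length)
open import Data.List.Relation.Unary.All using ([]; _∷_)
open import Data.List.Relation.Unary.AllPairs using ([]; _∷_)
open import Data.List.Relation.Unary.Any using (here; there)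
open import Data.List.Relation.Unary.Unique.Propositional using (Unique)
import Data.List.Relation.Unary.Unique.Propositional.Properties as Unique
open import Data.Nat
open import Data.Nat.DivMod
open import Data.Nat.Divisibility
  using (_∣_; divides; _∣?_; _∣0; ∣-trans; ∣1⇒≡1; ∣⇒≤; ∣m∣n⇒∣m+n; ∣m+n∣m⇒∣n; n∣m*n; m%n≡0⇒n∣m)
open import Data.Nat.GCD
  using (gcd; gcd-GCD; gcd[m,n]∣m; gcd[m,n]∣n; gcd[m,n]≢0; c*gcd[m,n]≡gcd[cm,cn]; module Bézout)
open import Data.Nat.Induction using (<-wellFounded)
open import Data.Nat.ListAction using (product)
open import Data.Nat.Primality using (Prime; euclidsLemma; prime⇒irreducible; ¬prime[0]; ¬prime[1])
open import Data.Nat.Primality.Factorisation using (factorise)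
open import Data.Nat.Properties
open import Data.Nat.Tactic.RingSolver using (solve-∀)
open import Data.Product using (Σ; ∃; ∃₂; _×_; _,_; proj₁; proj₂)
open import Data.Sum using (_⊎_; inj₁; inj₂)
open import Data.Vec using (Vec; []; _∷_; lookup; tabulate; replicate)
open import Data.Vec.Properties
  using (lookup∘tabulate; tabulate∘lookup; tabulate-cong; []=⇒lookup; lookup⇒[]=; lookup-replicate; ∷-injectiveʳ; ≡-dec)
open import Defs
open import Effect.Monad using (RawMonad)
open import Function using (_⇔_; mk⇔; Injective; Equivalence; _∘_)
open import Function.Construct.Composition using (_⇔-∘_)
open import Function.Construct.Symmetry using (⇔-sym)
open import Induction.WellFounded using (Acc; acc)
open import Level using (0ℓ)
open import Relation.Binary.Construct.Closure.ReflexiveTransitive using (Star; ε; _◅_)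
open import Relation.Binary.Definitions using (tri<; tri≈; tri>)
open import Relation.Binary.PropositionalEquality
open import Relation.Nullary using (¬_; Dec; yes; no; does; _×-dec_; ¬?; contradiction)
open import Relation.Nullary.Decidable using (dec-true; dec-false; decidable-stable)
open import Relation.Nullary.Decidable.Core using (¬¬-excluded-middle)
open import Relation.Nullary.Negation using (DoubleNegation; ¬¬-Monad)
open import Relation.Unary using (Pred; Decidable)
open import Relation.Unary.Properties using (_∩?_; ∁?)

open RawMonad (¬¬-Monad {0ℓ}) using (pure; _>>=_)

≡false⇔⇒≡ : ∀ {a b : Bool} → (a ≡ false → b ≡ false) → (b ≡ false → a ≡ false) → a ≡ b
≡false⇔⇒≡ {false} {false} _ _ = refl
≡false⇔⇒≡ {false} {true}  a⇒b _ = sym (a⇒b refl)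
≡false⇔⇒≡ {true}  {false} _ b⇒a = b⇒a refl
≡false⇔⇒≡ {true}  {true}  _ _ = refl

lookup-ext : ∀ {A : Set} {n} (u v : Vec A n) → (∀ i → lookup u i ≡ lookup v i) → u ≡ v
lookup-ext u v eq = trans (sym (tabulate∘lookup u)) (trans (tabulate-cong eq) (tabulate∘lookup v))

all≡false⇒ : ∀ {A : Set} (t : A → Bool) xs → all t xs ≡ false → ∃ λ x → x ∈ₗ xs × t x ≡ false
all≡false⇒ t (x ∷ xs) eq with t x in tx
... | false = x , here refl , tx
... | true  = let y , y∈xs , ty = all≡false⇒ t xs eq in y , there y∈xs , ty

all≡true⇒ : ∀ {A : Set} (t : A → Bool) xs → all t xs ≡ true → ∀ {x} → x ∈ₗ xs → t x ≡ true
all≡true⇒ t (y ∷ xs) eq x∈ with t y in ty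
all≡true⇒ t (y ∷ xs) eq (here refl) | true = ty
all≡true⇒ t (y ∷ xs) eq (there x∈) | true = all≡true⇒ t xs eq x∈

conj≡false⇒ : ∀ {n} (S : Subset n) u → conj S u ≡ false → ∃ λ i → i ∈ S × lookup u i ≡ false
conj≡false⇒ {n} S u eq with all≡false⇒ _ (allFin n) eq
... | i , _ , ui with lookup S i in Si
... | inside = i , lookup⇒[]= i S Si , ui

conj≡true⇒ : ∀ {n} (S : Subset n) u → conj S u ≡ true → ∀ {i} → i ∈ S → lookup u i ≡ true
conj≡true⇒ {n} S u eq {i} i∈S with all≡true⇒ _ (allFin n) eq (∈-allFin i)
... | ui with lookup S i | []=⇒lookup i∈S
... | inside | refl = ui

false-spreads⇒constant : ∀ {n} (u : Vec Bool n) → Fin n → (∀ i j → lookup u i ≡ false → lookup u j ≡ false)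
  → u ≡ replicate n false ⊎ u ≡ replicate n true
false-spreads⇒constant {n} u i₀ spreads with lookup u i₀ in ui₀
... | false = inj₁ (lookup-ext _ _ λ j → trans (spreads i₀ j ui₀) (sym (lookup-replicate j false)))
... | true  = inj₂ (lookup-ext _ _ λ j → trans (allTrue j) (sym (lookup-replicate j true)))
  where
  allTrue : ∀ j → lookup u j ≡ true
  allTrue j with lookup u j in uj
  ... | true  = refl
  ... | false = trans (sym (spreads j i₀ uj)) ui₀

splice : ∀ {A : Set} → ℕ → (ℕ → A) → (ℕ → A) → ℕ → A
splice a f g k = if does (k ≤? a) then f k else g k

splice-≤ : ∀ {A : Set} {a k} (f g : ℕ → A) → k ≤ a → splice a f g k ≡ f k
splice-≤ {a = a} {k} f g k≤a rewrite dec-true (k ≤? a) k≤a = refl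

splice-> : ∀ {A : Set} {a k} (f g : ℕ → A) → a < k → splice a f g k ≡ g k
splice-> {a = a} {k} f g a<k rewrite dec-false (k ≤? a) (<⇒≱ a<k) = refl

∣+⇒%≡ : ∀ {x y b d} .{{_ : NonZero d}} → d ∣ x + b → d ∣ y + b → x % d ≡ y % d
∣+⇒%≡ {x} {y} {b} {d} (divides q₁ eq₁) (divides q₂ eq₂) = begin
  x % d            ≡⟨ [m+kn]%n≡m%n x q₂ d ⟨
  (x + q₂ * d) % d ≡⟨ cong (_% d) same ⟩
  (y + q₁ * d) % d ≡⟨ [m+kn]%n≡m%n y q₁ d ⟩
  y % d            ∎
  where
  open ≡-Reasoning
  same : x + q₂ * d ≡ y + q₁ * d
  same = begin
    x + q₂ * d     ≡⟨ cong (λ z → x + z) eq₂ ⟨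
    x + (y + b)    ≡⟨ swap x y b ⟩
    y + (x + b)    ≡⟨ cong (λ z → y + z) eq₁ ⟩
    y + q₁ * d     ∎
    where
    swap : ∀ x y b → x + (y + b) ≡ y + (x + b)
    swap = solve-∀

%-∣ : ∀ {x y c} d .{{_ : NonZero c}} .{{_ : NonZero d}} → d ∣ c → x % c ≡ y % c → x % d ≡ y % d
%-∣ {x} {y} {c} d d∣c eq = begin
  x % d     ≡⟨ m∣n⇒o%n%m≡o%m d c x d∣c ⟨
  x % c % d ≡⟨ cong (_% d) eq ⟩
  y % c % d ≡⟨ m∣n⇒o%n%m≡o%m d c y d∣c ⟩
  y % d     ∎
  where open ≡-Reasoning

[m+n]%d≡m%d⇒d∣n : ∀ m n d .{{_ : NonZero d}} → (m + n) % d ≡ m % d → d ∣ n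
[m+n]%d≡m%d⇒d∣n m n d eq = ∣m+n∣m⇒∣n (subst (d ∣_) (sym quotients) (n∣m*n ((m + n) / d))) (n∣m*n (m / d))
  where
  quotients : m / d * d + n ≡ (m + n) / d * d
  quotients = +-cancelˡ-≡ (m % d) _ _ (begin
    m % d + (m / d * d + n)   ≡⟨ +-assoc (m % d) _ n ⟨
    m % d + m / d * d + n     ≡⟨ cong (_+ n) (m≡m%n+[m/n]*n m d) ⟨
    m + n                     ≡⟨ m≡m%n+[m/n]*n (m + n) d ⟩
    (m + n) % d + (m + n) / d * d ≡⟨ cong (_+ (m + n) / d * d) eq ⟩
    m % d + (m + n) / d * d   ∎)
    where open ≡-Reasoning

module _ {t : ℕ} .{{_ : NonZero t}} where

  %-cong-+ : ∀ {a b c d} → a % t ≡ b % t → c % t ≡ d % t → (a + c) % t ≡ (b + d) % t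
  %-cong-+ {a} {b} {c} {d} a≡b c≡d = begin
    (a + c) % t             ≡⟨ %-distribˡ-+ a c t ⟩
    (a % t + c % t) % t     ≡⟨ cong₂ (λ x y → (x + y) % t) a≡b c≡d ⟩
    (b % t + d % t) % t     ≡⟨ %-distribˡ-+ b d t ⟨
    (b + d) % t             ∎
    where open ≡-Reasoning

  %-cong-*ˡ : ∀ k {a b} → a % t ≡ b % t → (k * a) % t ≡ (k * b) % t
  %-cong-*ˡ k {a} {b} a≡b = begin
    (k * a) % t             ≡⟨ %-distribˡ-* k a t ⟩
    (k % t * (a % t)) % t   ≡⟨ cong (λ x → (k % t * x) % t) a≡b ⟩
    (k % t * (b % t)) % t   ≡⟨ %-distribˡ-* k b t ⟨
    (k * b) % t             ∎
    where open ≡-Reasoning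

+[m+n]-+m≡+n : ∀ m n → + (m + n) -ℤ + m ≡ + n
+[m+n]-+m≡+n m n = begin
  + (m + n) -ℤ + m ≡⟨ ℤ.[+m]-[+n]≡m⊖n (m + n) m ⟩
  (m + n) ⊖ m      ≡⟨ ℤ.⊖-≥ (m≤m+n m n) ⟩
  + (m + n ∸ m)    ≡⟨ cong +_ (m+n∸m≡n m n) ⟩
  + n              ∎
  where open ≡-Reasoning

prime⇒>1 : ∀ {p} → Prime p → 1 < p
prime⇒>1 {0}           p-prime = contradiction p-prime ¬prime[0]
prime⇒>1 {1}           p-prime = contradiction p-prime ¬prime[1]
prime⇒>1 {suc (suc p)} _       = s≤s (s≤s z≤n)

prime⇒>0 : ∀ {p} → Prime p → 0 < p
prime⇒>0 p-prime = <-trans (s≤s z≤n) (prime⇒>1 p-prime)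

∃primeDivisor : ∀ h → 1 < h → ∃ λ q → Prime q × q ∣ h
∃primeDivisor h@(suc _) 1<h with factorise h
... | record { factors = [] ; isFactorisation = h≡1 } = contradiction h≡1 (>⇒≢ 1<h)
... | record { factors = q ∷ qs ; isFactorisation = h≡ ; factorsPrime = q-prime ∷ _ } =
  q , q-prime , divides (product qs) (trans h≡ (*-comm q _))

primeDivisorOfPrimePower : ∀ {q p} e → Prime q → Prime p → q ∣ p ^ e → q ≡ p
primeDivisorOfPrimePower zero q-prime _ q∣1 = contradiction (subst Prime (∣1⇒≡1 q∣1) q-prime) ¬prime[1]
primeDivisorOfPrimePower {q} {p} (suc e) q-prime p-prime q∣pᵉ⁺¹ with euclidsLemma p (p ^ e) q-prime q∣pᵉ⁺¹
... | inj₂ q∣pᵉ = primeDivisorOfPrimePower e q-prime p-prime q∣pᵉ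
... | inj₁ q∣p with prime⇒irreducible p-prime q∣p
...   | inj₁ q≡1 = contradiction (subst Prime q≡1 q-prime) ¬prime[1]
...   | inj₂ q≡p = q≡p

distinctPrimes⇒gcd≡1 : ∀ {p q} → Prime p → Prime q → p ≢ q → gcd p q ≡ 1
distinctPrimes⇒gcd≡1 {p} {q} p-prime q-prime p≢q with prime⇒irreducible p-prime (gcd[m,n]∣m p q)
... | inj₁ d≡1 = d≡1
... | inj₂ d≡p with prime⇒irreducible q-prime (subst (_∣ q) d≡p (gcd[m,n]∣n p q))
...   | inj₁ p≡1 = contradiction (subst Prime p≡1 p-prime) ¬prime[1]
...   | inj₂ p≡q = contradiction p≡q p≢q

δ : ∀ {r} → Fin r → Fin r → ℕ
δ zero    zero    = 1
δ zero    (suc _) = 0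
δ (suc _) zero    = 0
δ (suc i) (suc j) = δ i j

lowerAt : ∀ {r} → (Fin r → ℕ) → Fin r → Fin r → ℕ
lowerAt k j i = k i ∸ δ j i

prodPow : ∀ r → (Fin r → ℕ) → (Fin r → ℕ) → ℕ
prodPow r p k = prodFin r (λ i → p i ^ k i)

prodPow-pos : ∀ r (p k : Fin r → ℕ) → (∀ i → 0 < p i) → 0 < prodPow r p k
prodPow-pos zero    p k p>0 = s≤s z≤n
prodPow-pos (suc r) p k p>0 =
  *-mono-≤ (m^n>0 (p zero) {{>-nonZero (p>0 zero)}} (k zero)) (prodPow-pos r (p ∘ suc) (k ∘ suc) (p>0 ∘ suc))

prodPow-lower : ∀ r (p k : Fin r → ℕ) → (∀ i → 0 < k i) → ∀ j → p j * prodPow r p (lowerAt k j) ≡ prodPow r p k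
prodPow-lower (suc r) p k k>0 zero with k zero | k>0 zero
... | suc _ | _ = sym (*-assoc (p zero) _ _)
prodPow-lower (suc r) p k k>0 (suc j) = begin
  p (suc j) * (p zero ^ k zero * rest)   ≡⟨ swap (p (suc j)) (p zero ^ k zero) rest ⟩
  p zero ^ k zero * (p (suc j) * rest)   ≡⟨ cong (p zero ^ k zero *_) (prodPow-lower r (p ∘ suc) (k ∘ suc) (k>0 ∘ suc) j) ⟩
  p zero ^ k zero * prodPow r (p ∘ suc) (k ∘ suc) ∎
  where
  open ≡-Reasoning
  rest = prodPow r (p ∘ suc) (lowerAt (k ∘ suc) j)
  swap : ∀ a b c → a * (b * c) ≡ b * (a * c)
  swap = solve-∀

primeDivisorOfProdPow : ∀ r (p k : Fin r → ℕ) {q} → (∀ i → Prime (p i)) → Prime q → q ∣ prodPow r p k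
  → ∃ λ j → q ≡ p j
primeDivisorOfProdPow zero    p k p-prime q-prime q∣1 = contradiction (subst Prime (∣1⇒≡1 q∣1) q-prime) ¬prime[1]
primeDivisorOfProdPow (suc r) p k p-prime q-prime q∣m with euclidsLemma (p zero ^ k zero) _ q-prime q∣m
... | inj₁ q∣p₀ᵏ = zero , primeDivisorOfPrimePower (k zero) q-prime (p-prime zero) q∣p₀ᵏ
... | inj₂ q∣rest =
  let j , q≡pⱼ = primeDivisorOfProdPow r (p ∘ suc) (k ∘ suc) (p-prime ∘ suc) q-prime q∣rest in
  suc j , q≡pⱼ

∣-cofactor : ∀ {p a h g} .{{_ : NonZero p}} → p * a ≡ h * g → p ∣ h → g ∣ a
∣-cofactor {p} {a} {g = g} eq (divides h′ refl) = divides h′ (*-cancelˡ-≡ a (h′ * g) p (trans eq (swap h′ p g)))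
  where
  swap : ∀ a b c → a * b * c ≡ b * (a * c)
  swap = solve-∀

-- m / g has a prime divisor pⱼ, and then g ∣ m / pⱼ.
properDivisor∣prodPow-lower : ∀ r (p k : Fin r → ℕ) → (∀ i → Prime (p i)) → (∀ i → 0 < k i)
  → ∀ {g} → g ∣ prodPow r p k → g ≢ prodPow r p k → ∃ λ j → g ∣ prodPow r p (lowerAt k j)
properDivisor∣prodPow-lower r p k p-prime k>0 {g} (divides h m≡hg) g≢m =
  let q , q-prime , q∣h = ∃primeDivisor h (cofactor>1 h m≡hg)
      j , q≡pⱼ = primeDivisorOfProdPow r p k p-prime q-prime (∣-trans q∣h (divides g (trans m≡hg (*-comm h g))))
  in j , ∣-cofactor {{>-nonZero (prime⇒>0 (p-prime j))}} (trans (prodPow-lower r p k k>0 j) m≡hg) (subst (_∣ h) q≡pⱼ q∣h)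
  where
  cofactor>1 : ∀ h → prodPow r p k ≡ h * g → 1 < h
  cofactor>1 0             m≡0 = contradiction m≡0 (>⇒≢ (prodPow-pos r p k (prime⇒>0 ∘ p-prime)))
  cofactor>1 1             m≡g = contradiction (trans m≡g (+-identityʳ g)) (g≢m ∘ sym)
  cofactor>1 (suc (suc _)) _   = s≤s (s≤s z≤n)

unique-sameElements⇒length : ∀ {A : Set} {xs ys : List A} → Unique xs → Unique ys
  → (∀ {x} → x ∈ₗ xs ⇔ x ∈ₗ ys) → length xs ≡ length ys
unique-sameElements⇒length uxs uys same = ↭-length (∼bag⇒↭ (unique∧set⇒bag uxs uys same))

hasCardinality-unique : ∀ {A : Set} {P : A → Set} {a b} → HasCardinality P a → HasCardinality P b → a ≡ b
hasCardinality-unique (xs , uxs , xs⇔P , refl) (ys , uys , ys⇔P , refl) =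
  unique-sameElements⇒length uxs uys λ {x} → ⇔-sym (ys⇔P x) ⇔-∘ xs⇔P x

hasCardinality-image : ∀ {A B : Set} {P : A → Set} (ψ : B → A) {xs : List B} → Unique xs → (∀ b → b ∈ₗ xs)
  → Injective _≡_ _≡_ ψ → (∀ a → P a ⇔ ∃ λ b → ψ b ≡ a) → HasCardinality P (length xs)
hasCardinality-image {P = P} ψ {xs} uxs complete ψ-inj P⇔image =
  map ψ xs , Unique.map⁺ ψ-inj uxs , (λ a → mk⇔ (to a) (from a)) , length-map ψ xs
  where
  to : ∀ a → a ∈ₗ map ψ xs → P a
  to a a∈ = let b , _ , a≡ψb = ∈-map⁻ ψ a∈ in Equivalence.from (P⇔image a) (b , sym a≡ψb)
  from : ∀ a → P a → a ∈ₗ map ψ xs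
  from a Pa with Equivalence.to (P⇔image a) Pa
  ... | b , refl = ∈-map⁺ ψ (complete b)

hasCardinality-⇔ : ∀ {A : Set} {P Q : A → Set} {N} → (∀ a → P a ⇔ Q a) → HasCardinality P N → HasCardinality Q N
hasCardinality-⇔ P⇔Q (xs , unique , xs⇔P , length≡) =
  xs , unique , (λ a → P⇔Q a ⇔-∘ xs⇔P a) , length≡

allVecs : ∀ n → List (Vec Bool n)
allVecs zero    = [] ∷ []
allVecs (suc n) = map (true ∷_) (allVecs n) ++ map (false ∷_) (allVecs n)

∈-allVecs : ∀ {n} (u : Vec Bool n) → u ∈ₗ allVecs n
∈-allVecs []            = here refl
∈-allVecs (true  ∷ u)   = ∈-++⁺ˡ (∈-map⁺ (true ∷_) (∈-allVecs u))
∈-allVecs {suc n} (false ∷ u) = ∈-++⁺ʳ (map (true ∷_) (allVecs n)) (∈-map⁺ (false ∷_) (∈-allVecs u))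

allVecs-unique : ∀ n → Unique (allVecs n)
allVecs-unique zero    = [] ∷ []
allVecs-unique (suc n) = Unique.++⁺ (Unique.map⁺ ∷-injectiveʳ (allVecs-unique n))
  (Unique.map⁺ ∷-injectiveʳ (allVecs-unique n)) disjoint
  where
  disjoint : ∀ {v} → ¬ (v ∈ₗ map (true ∷_) (allVecs n) × v ∈ₗ map (false ∷_) (allVecs n))
  disjoint (v∈₁ , v∈₂) with ∈-map⁻ (true ∷_) v∈₁ | ∈-map⁻ (false ∷_) v∈₂
  ... | _ , _ , refl | _ , _ , ()

length-allVecs : ∀ n → length (allVecs n) ≡ 2 ^ n
length-allVecs zero    = refl
length-allVecs (suc n) = begin
  length (map (true ∷_) (allVecs n) ++ map (false ∷_) (allVecs n))
    ≡⟨ length-++ (map (true ∷_) (allVecs n)) ⟩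
  length (map (true ∷_) (allVecs n)) + length (map (false ∷_) (allVecs n))
    ≡⟨ cong₂ _+_ (length-map (true ∷_) (allVecs n)) (length-map (false ∷_) (allVecs n)) ⟩
  length (allVecs n) + length (allVecs n)
    ≡⟨ cong₂ _+_ (length-allVecs n) (trans (length-allVecs n) (sym (+-identityʳ (2 ^ n)))) ⟩
  2 ^ suc n ∎
  where open ≡-Reasoning

vecs-hasCardinality : ∀ {A : Set} {P : A → Set} {m} (ψ : Vec Bool m → A) → Injective _≡_ _≡_ ψ
  → (∀ a → P a ⇔ ∃ λ g → ψ g ≡ a) → HasCardinality P (2 ^ m)
vecs-hasCardinality {m = m} ψ ψ-inj P⇔image =
  subst (HasCardinality _) (length-allVecs m) (hasCardinality-image ψ (allVecs-unique m) ∈-allVecs ψ-inj P⇔image)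

module _ {n : ℕ} where

  count : {P : Pred (Vec Bool n) 0ℓ} → Decidable P → ℕ
  count P? = length (filter P? (allVecs n))

  count-hasCardinality : {P : Pred (Vec Bool n) 0ℓ} (P? : Decidable P) → HasCardinality P (count P?)
  count-hasCardinality P? = filter P? (allVecs n) , Unique.filter⁺ P? (allVecs-unique n) ,
    (λ u → mk⇔ (λ u∈ → proj₂ (∈-filter⁻ P? {xs = allVecs n} u∈)) (∈-filter⁺ P? (∈-allVecs u))) , refl

  count-cong : {P R : Pred (Vec Bool n) 0ℓ} (P? : Decidable P) (R? : Decidable R) → (∀ u → P u ⇔ R u)
    → count P? ≡ count R?
  count-cong P? R? P⇔R =
    cong length (filter-≐ P? R? ((λ {u} → Equivalence.to (P⇔R u)) , (λ {u} → Equivalence.from (P⇔R u))) (allVecs n))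

  count-split : {P R : Pred (Vec Bool n) 0ℓ} (P? : Decidable P) (R? : Decidable R)
    → count P? ≡ count (P? ∩? R?) + count (P? ∩? ∁? R?)
  count-split P? R? = go (allVecs n)
    where
    go : ∀ xs → length (filter P? xs) ≡ length (filter (P? ∩? R?) xs) + length (filter (P? ∩? ∁? R?) xs)
    go []       = refl
    go (x ∷ xs) with P? x | R? x
    ... | yes _ | yes _ = cong suc (go xs)
    ... | yes _ | no _  = trans (cong suc (go xs)) (sym (+-suc _ _))
    ... | no _  | _     = go xs

_◂_ : ∀ {r} → Fin 2 → (Fin r → Fin 2) → Fin (suc r) → Fin 2
(b ◂ is) zero    = b
(b ◂ is) (suc i) = is i

◂-cong : ∀ {r} b {is js : Fin r → Fin 2} → is ≗ js → b ◂ is ≗ b ◂ js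
◂-cong b is≗js zero    = refl
◂-cong b is≗js (suc i) = is≗js i

nestedSum01-cong : ∀ r {f g : (Fin r → Fin 2) → ℤ} → (∀ {is js} → is ≗ js → f is ≡ g js)
  → nestedSum01 r f ≡ nestedSum01 r g
nestedSum01-cong zero    f≗g = f≗g (λ ())
nestedSum01-cong (suc r) f≗g = cong₂ _+ℤ_
  (nestedSum01-cong r (λ is≗js → f≗g λ { zero → refl ; (suc i) → is≗js i }))
  (nestedSum01-cong r (λ is≗js → f≗g λ { zero → refl ; (suc i) → is≗js i }))

Respects≗ : ∀ {r} → ((Fin r → Fin 2) → ℤ) → Set
Respects≗ f = ∀ {is js} → is ≗ js → f is ≡ f js

-- nestedSum01 recurses through a local cons that agrees with _◂_ only pointwise.
nestedSum01-suc : ∀ r (f : (Fin (suc r) → Fin 2) → ℤ) → Respects≗ f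
  → nestedSum01 (suc r) f ≡ nestedSum01 r (λ is → f (zero ◂ is)) +ℤ nestedSum01 r (λ is → f (suc zero ◂ is))
nestedSum01-suc r f f-cong = cong₂ _+ℤ_
  (nestedSum01-cong r (λ is≗js → f-cong λ { zero → refl ; (suc i) → is≗js i }))
  (nestedSum01-cong r (λ is≗js → f-cong λ { zero → refl ; (suc i) → is≗js i }))

nestedSum01-neg : ∀ r (f : (Fin r → Fin 2) → ℤ) → Respects≗ f → nestedSum01 r (λ is → - f is) ≡ - nestedSum01 r f
nestedSum01-neg zero    f f-cong = refl
nestedSum01-neg (suc r) f f-cong = begin
  nestedSum01 (suc r) (λ is → - f is)         ≡⟨ nestedSum01-suc r _ (cong -_ ∘ f-cong) ⟩
  nestedSum01 r _ +ℤ nestedSum01 r _          ≡⟨ cong₂ _+ℤ_ (neg-half zero) (neg-half (suc zero)) ⟩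
  - nestedSum01 r _ +ℤ - nestedSum01 r _      ≡⟨ ℤ.neg-distrib-+ (half zero) (half (suc zero)) ⟨
  - (half zero +ℤ half (suc zero))            ≡⟨ cong -_ (nestedSum01-suc r f f-cong) ⟨
  - nestedSum01 (suc r) f                     ∎
  where
  open ≡-Reasoning
  half : Fin 2 → ℤ
  half b = nestedSum01 r (λ is → f (b ◂ is))
  neg-half : ∀ b → nestedSum01 r (λ is → - f (b ◂ is)) ≡ - half b
  neg-half b = nestedSum01-neg r (λ is → f (b ◂ is)) (λ is≗js → f-cong (◂-cong b is≗js))

sumFin-cong : ∀ r {f g : Fin r → ℕ} → f ≗ g → sumFin r f ≡ sumFin r g
sumFin-cong zero    f≗g = refl
sumFin-cong (suc r) f≗g = cong₂ _+_ (f≗g zero) (sumFin-cong r (f≗g ∘ suc))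

prodFin-cong : ∀ r {f g : Fin r → ℕ} → f ≗ g → prodFin r f ≡ prodFin r g
prodFin-cong zero    f≗g = refl
prodFin-cong (suc r) f≗g = cong₂ _*_ (f≗g zero) (prodFin-cong r (f≗g ∘ suc))

scaledPeriodTerm : ∀ r → ℕ → (p k : Fin r → ℕ) → (Fin r → Fin 2) → ℤ
scaledPeriodTerm r B p k is = signPow (sumFin r (toN2 ∘ is)) *ℤ + (2 ^ (B * prodPow r p (λ j → k j ∸ toN2 (is j))))

scaledPeriodTerm-cong : ∀ r B p k → Respects≗ (scaledPeriodTerm r B p k)
scaledPeriodTerm-cong r B p k is≗js = cong₂ (λ s e → signPow s *ℤ + (2 ^ (B * e)))
  (sumFin-cong r (cong toN2 ∘ is≗js)) (prodFin-cong r (λ j → cong (λ i → p j ^ (k j ∸ toN2 i)) (is≗js j)))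

scaledPeriodFormula : ∀ r → ℕ → (p k : Fin r → ℕ) → ℤ
scaledPeriodFormula r B p k = nestedSum01 r (scaledPeriodTerm r B p k)

-- Splitting on i₁ ∈ {0, 1} moves the factor p₁^(k₁ - i₁) into the base B.
scaledPeriodFormula-suc : ∀ r B (p k : Fin (suc r) → ℕ)
  → scaledPeriodFormula (suc r) B p k
    ≡ scaledPeriodFormula r (B * p zero ^ k zero) (p ∘ suc) (k ∘ suc)
      -ℤ scaledPeriodFormula r (B * p zero ^ (k zero ∸ 1)) (p ∘ suc) (k ∘ suc)
scaledPeriodFormula-suc r B p k = begin
  scaledPeriodFormula (suc r) B p k
    ≡⟨ nestedSum01-suc r _ (scaledPeriodTerm-cong (suc r) B p k) ⟩
  nestedSum01 r (λ is → scaledPeriodTerm (suc r) B p k (zero ◂ is))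
    +ℤ nestedSum01 r (λ is → scaledPeriodTerm (suc r) B p k (suc zero ◂ is))
    ≡⟨ cong₂ _+ℤ_ (nestedSum01-cong r (λ is≗js → trans (scaledPeriodTerm-◂0 _) (scaledPeriodTerm-cong r B₀ _ _ is≗js)))
                  (trans (nestedSum01-cong r (λ is≗js → trans (scaledPeriodTerm-◂1 _) (cong -_ (scaledPeriodTerm-cong r B₁ _ _ is≗js))))
                         (nestedSum01-neg r _ (scaledPeriodTerm-cong r B₁ _ _))) ⟩
  scaledPeriodFormula r B₀ (p ∘ suc) (k ∘ suc) -ℤ scaledPeriodFormula r B₁ (p ∘ suc) (k ∘ suc) ∎
  where
  open ≡-Reasoning
  B₀ = B * p zero ^ k zero
  B₁ = B * p zero ^ (k zero ∸ 1)
  rest : (Fin r → Fin 2) → ℕ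
  rest is = prodPow r (p ∘ suc) (λ j → k (suc j) ∸ toN2 (is j))
  scaledPeriodTerm-◂0 : ∀ is → scaledPeriodTerm (suc r) B p k (zero ◂ is) ≡ scaledPeriodTerm r B₀ (p ∘ suc) (k ∘ suc) is
  scaledPeriodTerm-◂0 is = cong (λ e → signPow (sumFin r (toN2 ∘ is)) *ℤ + (2 ^ e)) (sym (*-assoc B (p zero ^ k zero) (rest is)))
  scaledPeriodTerm-◂1 : ∀ is → scaledPeriodTerm (suc r) B p k (suc zero ◂ is) ≡ - scaledPeriodTerm r B₁ (p ∘ suc) (k ∘ suc) is
  scaledPeriodTerm-◂1 is = trans
    (cong (λ e → - signPow (sumFin r (toN2 ∘ is)) *ℤ + (2 ^ e)) (sym (*-assoc B (p zero ^ (k zero ∸ 1)) (rest is))))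
    (sym (ℤ.neg-distribˡ-* (signPow (sumFin r (toN2 ∘ is))) _))

scaledPeriodFormula-1 : ∀ r p k → scaledPeriodFormula r 1 p k ≡ periodFormula r p k
scaledPeriodFormula-1 r p k = nestedSum01-cong r λ {_} {js} is≗js → trans (scaledPeriodTerm-cong r 1 p k is≗js)
  (cong (λ e → signPow (sumFin r (toN2 ∘ js)) *ℤ + (2 ^ e)) (*-identityˡ (prodPow r p (λ j → k j ∸ toN2 (js j)))))

module Dynamics {n : ℕ} (deps : Network n) where

  FixedBy : ℕ → Vec Bool n → Set
  FixedBy M u = iter deps M u ≡ u

  fixedBy-≡ : ∀ {a b u} → a ≡ b → FixedBy a u → FixedBy b u
  fixedBy-≡ {u = u} = subst (λ M → FixedBy M u)

  iter-+ : ∀ a b u → iter deps (a + b) u ≡ iter deps a (iter deps b u)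
  iter-+ zero    b u = refl
  iter-+ (suc a) b u = cong (apply deps) (iter-+ a b u)

  fixedBy-* : ∀ k {M u} → FixedBy M u → FixedBy (k * M) u
  fixedBy-* zero        fix = refl
  fixedBy-* (suc k) {M} {u} fix = begin
    iter deps (M + k * M) u        ≡⟨ iter-+ M (k * M) u ⟩
    iter deps M (iter deps (k * M) u) ≡⟨ cong (iter deps M) (fixedBy-* k fix) ⟩
    iter deps M u                  ≡⟨ fix ⟩
    u                              ∎
    where open ≡-Reasoning

  fixedBy-∣ : ∀ {a b u} → a ∣ b → FixedBy a u → FixedBy b u
  fixedBy-∣ (divides q refl) = fixedBy-* q

  fixedBy-+⁻ : ∀ {d e u} → FixedBy e u → FixedBy (d + e) u → FixedBy d u
  fixedBy-+⁻ {d} {e} {u} fe fde = begin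
    iter deps d u               ≡⟨ cong (iter deps d) fe ⟨
    iter deps d (iter deps e u) ≡⟨ iter-+ d e u ⟨
    iter deps (d + e) u         ≡⟨ fde ⟩
    u                           ∎
    where open ≡-Reasoning

  fixedBy-gcd : ∀ {a b u} → FixedBy a u → FixedBy b u → FixedBy (gcd a b) u
  fixedBy-gcd {a} {b} {u} fa fb with Bézout.identity (gcd-GCD a b)
  ... | Bézout.+- x y eq = fixedBy-+⁻ {gcd a b} {y * b} (fixedBy-* y fb) (fixedBy-≡ (sym eq) (fixedBy-* x fa))
  ... | Bézout.-+ x y eq = fixedBy-+⁻ {gcd a b} {x * a} (fixedBy-* x fa) (fixedBy-≡ (sym eq) (fixedBy-* y fb))

  fixedBy-distinctPrimes : ∀ {X p q u} → Prime p → Prime q → p ≢ q → FixedBy (X * p) u → FixedBy (X * q) u → FixedBy X u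
  fixedBy-distinctPrimes {X} {p} {q} {u} p-prime q-prime p≢q fp fq = fixedBy-≡ gcd≡X (fixedBy-gcd {X * p} {X * q} fp fq)
    where
    gcd≡X : gcd (X * p) (X * q) ≡ X
    gcd≡X = begin
      gcd (X * p) (X * q) ≡⟨ c*gcd[m,n]≡gcd[cm,cn] X p q ⟨
      X * gcd p q         ≡⟨ cong (X *_) (distinctPrimes⇒gcd≡1 p-prime q-prime p≢q) ⟩
      X * 1               ≡⟨ *-identityʳ X ⟩
      X                   ∎
      where open ≡-Reasoning

  fixedPoint-period : ∀ {u t} → IsFixedPoint deps u → HasPeriod deps u t → t ≡ 1
  fixedPoint-period {t = suc zero}    _     _                 = refl
  fixedPoint-period {t = suc (suc _)} fixed (_ , _ , minimal) = contradiction fixed (minimal 1 ≤-refl (s≤s (s≤s z≤n)))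

  lookup-apply : ∀ u j → lookup (apply deps u) j ≡ conj (deps j) u
  lookup-apply u = lookup∘tabulate _

  false-isFixedPoint : IsConjunctive deps → IsFixedPoint deps (replicate n false)
  false-isFixedPoint isC = lookup-ext _ _ λ j → begin
    lookup (apply deps (replicate n false)) j ≡⟨ lookup-apply _ j ⟩
    conj (deps j) (replicate n false)        ≡⟨ conj-false j ⟩
    false                                    ≡⟨ lookup-replicate j false ⟨
    lookup (replicate n false) j             ∎
    where
    open ≡-Reasoning
    conj-false : ∀ j → conj (deps j) (replicate n false) ≡ false
    conj-false j with conj (deps j) (replicate n false) in eq
    ... | false = refl
    ... | true  = let i , i∈ = isC j in
      trans (sym (conj≡true⇒ (deps j) _ eq i∈)) (lookup-replicate i false)

  true-isFixedPoint : IsFixedPoint deps (replicate n true)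
  true-isFixedPoint = lookup-ext _ _ λ j → begin
    lookup (apply deps (replicate n true)) j ≡⟨ lookup-apply _ j ⟩
    conj (deps j) (replicate n true)        ≡⟨ conj-true j ⟩
    true                                    ≡⟨ lookup-replicate j true ⟨
    lookup (replicate n true) j             ∎
    where
    open ≡-Reasoning
    conj-true : ∀ j → conj (deps j) (replicate n true) ≡ true
    conj-true j with conj (deps j) (replicate n true) in eq
    ... | true  = refl
    ... | false = let i , _ , ui = conj≡false⇒ (deps j) _ eq in
      trans (sym ui) (lookup-replicate i true)

  data Walk : Fin n → Fin n → ℕ → Set where
    []  : ∀ {i} → Walk i i 0
    _∷ʳ_ : ∀ {i k j L} → Walk i k L → Edge deps k j → Walk i j (suc L)

  _++ᵂ_ : ∀ {i k j a b} → Walk i k a → Walk k j b → Walk i j (b + a)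
  w ++ᵂ []        = w
  w ++ᵂ (w′ ∷ʳ e) = (w ++ᵂ w′) ∷ʳ e

  replicateᵂ : ∀ {i L} k → Walk i i L → Walk i i (k * L)
  replicateᵂ zero    w = []
  replicateᵂ {L = L} (suc k) w = subst (Walk _ _) (+-comm (k * L) L) (w ++ᵂ replicateᵂ k w)

  fromStar : ∀ {i j} → Star (Edge deps) i j → ∃ λ L → Walk i j L
  fromStar ε       = 0 , []
  fromStar (e ◅ s) = let L , w = fromStar s in L + 1 , ([] ∷ʳ e) ++ᵂ w

  firstEdge : ∀ {i j L} → Walk i j (suc L) → ∃ λ k → Edge deps i k
  firstEdge ([] ∷ʳ e)        = _ , e
  firstEdge ((w ∷ʳ e′) ∷ʳ e) = firstEdge (w ∷ʳ e′)

  simpleCycle⇒closedWalk : ∀ {len} → SimpleCycle deps len → ∃ λ i → Walk i i len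
  simpleCycle⇒closedWalk cycle = v zero , subst (Walk (v zero) (v zero)) (sym len≡) (walkAlong l ≤-refl ∷ʳ close′)
    where
    open SimpleCycle cycle
    walkAlong : ∀ m (m≤l : m ≤ l) → Walk (v zero) (v (fromℕ< (s≤s m≤l))) m
    walkAlong zero    m≤l = []
    walkAlong (suc m) m≤l = walkAlong m (<⇒≤ m≤l) ∷ʳ subst₂ (λ x y → Edge deps (v x) (v y))
      (toℕ-injective (trans (toℕ-inject₁ _) (trans (toℕ-fromℕ< m≤l) (sym (toℕ-fromℕ< _)))))
      (toℕ-injective (trans (cong suc (toℕ-fromℕ< m≤l)) (sym (toℕ-fromℕ< (s≤s m≤l)))))
      (step (fromℕ< m≤l))
    close′ : Edge deps (v (fromℕ< (s≤s (≤-refl {l})))) (v zero)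
    close′ = subst (λ x → Edge deps (v x) (v zero)) (toℕ-injective (trans (toℕ-fromℕ l) (sym (toℕ-fromℕ< _)))) close

  walk-true : ∀ {i j L} u → Walk i j L → lookup (iter deps L u) j ≡ true → lookup u i ≡ true
  walk-true u []         uj = uj
  walk-true {j = j} {suc L} u (_∷ʳ_ {k = k} w e) uj =
    walk-true u w (conj≡true⇒ (deps j) (iter deps L u) (trans (sym (lookup-apply _ j)) uj) e)

  walk-false : ∀ {i j L} u → Walk i j L → lookup u i ≡ false → lookup (iter deps L u) j ≡ false
  walk-false {i} {j} {L} u w ui with lookup (iter deps L u) j in uj
  ... | false = refl
  ... | true  = trans (sym (walk-true u w uj)) ui

  iter-false⇒walk : ∀ L u {j} → lookup (iter deps L u) j ≡ false → ∃ λ i → Walk i j L × lookup u i ≡ false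
  iter-false⇒walk zero    u uj = _ , [] , uj
  iter-false⇒walk (suc L) u {j} uj with conj≡false⇒ (deps j) (iter deps L u) (trans (sym (lookup-apply _ j)) uj)
  ... | k , e , uk = let i , w , ui = iter-false⇒walk L u uk in i , w ∷ʳ e , ui

  fixedBy-walk : ∀ {M i j L} u → FixedBy M u → Walk i j L → M ∣ L → lookup u i ≡ false → lookup u j ≡ false
  fixedBy-walk {j = j} u fix w (divides q refl) ui =
    subst (λ v → lookup v j ≡ false) (fixedBy-* q fix) (walk-false u w ui)

  Path : ℕ → (ℕ → Fin n) → Set
  Path L w = ∀ k → k < L → Edge deps (w k) (w (suc k))

  ClosedPath : ℕ → (ℕ → Fin n) → Set
  ClosedPath L w = Path L w × w L ≡ w 0

  walk⇒path : ∀ {i j L} → Walk i j L → ∃ λ w → w 0 ≡ i × w L ≡ j × Path L w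
  walk⇒path {i} []                      = (λ _ → i) , refl , refl , λ k ()
  walk⇒path {j = j} {suc L} (w ∷ʳ e) with walk⇒path w
  ... | f , f0 , fL , path =
    splice L f (λ _ → j) , trans (splice-≤ {a = L} f (λ _ → j) z≤n) f0 , splice-> f (λ _ → j) ≤-refl , path′
    where
    path′ : Path (suc L) (splice L f (λ _ → j))
    path′ k (s≤s k≤L) with m≤n⇒m<n∨m≡n k≤L
    ... | inj₁ k<L rewrite splice-≤ f (λ _ → j) k≤L | splice-≤ f (λ _ → j) k<L = path k k<L
    ... | inj₂ refl rewrite splice-≤ f (λ _ → j) k≤L | splice-> f (λ _ → j) (n<1+n k) = subst (λ v → Edge deps v j) (sym fL) e

-- Decomposing closed walks into cycles

module CycleDecomposition {n : ℕ} (deps : Network n) (c : ℕ)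
  (c∣cycles : ∀ len → SimpleCycle deps len → c ∣ len) where

  open Dynamics deps

  RepeatedVertex : ℕ → (ℕ → Fin n) → Set
  RepeatedVertex L w = ∃₂ λ a d → ∃ λ r → L ≡ a + suc d + suc r × w a ≡ w (a + suc d)

  repeatedVertex : ∀ {L w x y} → x < y → y < L → w x ≡ w y → RepeatedVertex L w
  repeatedVertex {w = w} {x} x<y y<L eq with m≤n⇒∃[o]m+o≡n x<y
  ... | d , refl with m≤n⇒∃[o]m+o≡n y<L
  ... | r , refl = x , d , r , shape x d r , trans eq (cong w (sym (+-suc x d)))
    where
    shape : ∀ x d r → suc (suc x + d) + r ≡ x + suc d + suc r
    shape = solve-∀

  simpleCycle : ∀ {l w} → ¬ RepeatedVertex (suc l) w → ClosedPath (suc l) w → SimpleCycle deps (suc l)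
  simpleCycle {l} {w} noRepeat (path , closed) = record
    { l = l ; len≡ = refl ; v = λ i → w (toℕ i) ; simple = injective ; step = step ; close = close }
    where
    injective : ∀ {x y : Fin (suc l)} → w (toℕ x) ≡ w (toℕ y) → x ≡ y
    injective {x} {y} eq with <-cmp (toℕ x) (toℕ y)
    ... | tri< x<y _ _ = contradiction (repeatedVertex x<y (toℕ<n y) eq) noRepeat
    ... | tri≈ _ x≡y _ = toℕ-injective x≡y
    ... | tri> _ _ y<x = contradiction (repeatedVertex y<x (toℕ<n x) (sym eq)) noRepeat
    step : ∀ (k : Fin l) → Edge deps (w (toℕ (inject₁ k))) (w (toℕ (suc k)))
    step k rewrite toℕ-inject₁ k = path (toℕ k) (m<n⇒m<1+n (toℕ<n k))
    close : Edge deps (w (toℕ (fromℕ l))) (w 0)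
    close rewrite toℕ-fromℕ l = subst (Edge deps (w l)) closed (path l ≤-refl)

  -- Cutting the loop w a → ⋯ → w (a + suc d) out of w leaves the second closed path.
  splitClosedPath : ∀ {w} a d r → ClosedPath (a + suc d + suc r) w → w a ≡ w (a + suc d)
    → ClosedPath (suc d) (λ k → w (a + k))
      × ClosedPath (a + suc r) (splice a w (λ k → w (k + suc d)))
  splitClosedPath {w} a d r (path , closed) repeat = (path₁ , closed₁) , (path₂ , closed₂)
    where
    w₂ = splice a w (λ k → w (k + suc d))
    L≡ : a + suc r + suc d ≡ a + suc d + suc r
    L≡ = swap a r d
      where
      swap : ∀ a r d → a + suc r + suc d ≡ a + suc d + suc r
      swap = solve-∀
    path₁ : Path (suc d) (λ k → w (a + k))
    path₁ k k<d rewrite +-suc a k =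
      path (a + k) (<-≤-trans (+-monoʳ-< a k<d) (m≤m+n (a + suc d) (suc r)))
    closed₁ : w (a + suc d) ≡ w (a + 0)
    closed₁ = trans (sym repeat) (cong w (sym (+-identityʳ a)))
    path₂ : Path (a + suc r) w₂
    path₂ k k<L with <-cmp k a
    ... | tri< k<a _ _ rewrite splice-≤ w (λ k → w (k + suc d)) (<⇒≤ k<a) | splice-≤ w (λ k → w (k + suc d)) k<a =
      path k (<-≤-trans k<a (≤-trans (m≤m+n a (suc d)) (m≤m+n _ (suc r))))
    ... | tri≈ _ refl _ rewrite splice-≤ w (λ k → w (k + suc d)) (≤-refl {k}) | splice-> w (λ k → w (k + suc d)) (n<1+n k) =
      subst (λ v → Edge deps v (w (suc (k + suc d)))) (sym repeat) (path (k + suc d) (m<m+n (k + suc d) (s≤s z≤n)))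
    ... | tri> _ _ a<k rewrite splice-> w (λ k → w (k + suc d)) a<k | splice-> w (λ k → w (k + suc d)) (m<n⇒m<1+n a<k) =
      path (k + suc d) (subst (k + suc d <_) L≡ (+-monoˡ-< (suc d) k<L))
    closed₂ : w₂ (a + suc r) ≡ w₂ 0
    closed₂ rewrite splice-> w (λ k → w (k + suc d)) (≤-<-trans (m≤m+n a r) (≤-reflexive (sym (+-suc a r)))) =
      trans (cong w L≡) closed

  closedPath-divisible : ∀ L → Acc _<_ L → ∀ {w} → ClosedPath L w → DoubleNegation (c ∣ L)
  closedPath-divisible zero    _        _ = pure (c ∣0)
  closedPath-divisible (suc l) (acc rs) {w} closedPath = ¬¬-excluded-middle >>= byRepeat
    where
    sum : ∀ a d r → suc d + (a + suc r) ≡ a + suc d + suc r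
    sum = solve-∀
    shorter₁ : ∀ a d r → suc d < a + suc d + suc r
    shorter₁ a d r = subst (suc d <_) (sum a d r) (m<m+n (suc d) (≤-trans (s≤s z≤n) (≤-reflexive (sym (+-suc a r)))))
    shorter₂ : ∀ a d r → a + suc r < a + suc d + suc r
    shorter₂ a d r = subst (a + suc r <_) (sum a d r) (m<n+m (a + suc r) {suc d} (s≤s z≤n))
    byRepeat : Dec (RepeatedVertex (suc l) w) → DoubleNegation (c ∣ suc l)
    byRepeat (no noRepeat) = pure (c∣cycles (suc l) (simpleCycle noRepeat closedPath))
    byRepeat (yes (a , d , r , eq , repeat)) =
      let closed₁ , closed₂ = splitClosedPath a d r (subst (λ L → ClosedPath L w) eq closedPath) repeat in
      closedPath-divisible (suc d) (rs (shorter (shorter₁ a d r))) closed₁ >>= λ c∣₁ →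
      closedPath-divisible (a + suc r) (rs (shorter (shorter₂ a d r))) closed₂ >>= λ c∣₂ →
      pure (subst (c ∣_) (trans (sum a d r) (sym eq)) (∣m∣n⇒∣m+n c∣₁ c∣₂))
      where
      shorter : ∀ {k} → k < a + suc d + suc r → k < suc l
      shorter {k} = subst (k <_) (sym eq)

  closedWalk-divisible : ∀ {i L} → Walk i i L → c ∣ L
  closedWalk-divisible {L = L} w =
    let f , f0 , fL , path = walk⇒path w in
    decidable-stable (c ∣? L) (closedPath-divisible L (<-wellFounded L) (path , trans fL (sym f0)))

-- Levels modulo the loop number

module Levels {n : ℕ} (deps : Network n) (isC : IsConjunctive deps) (sc : StronglyConnected deps)
  (c : ℕ) .{{_ : NonZero c}} (c∣cycles : ∀ len → SimpleCycle deps len → c ∣ len) where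

  open Dynamics deps
  open CycleDecomposition deps c c∣cycles

  root : Fin n
  root = proj₁ (proj₂ sc)

  level : Fin n → ℕ
  level j = proj₁ (fromStar (proj₁ sc root j))

  walkFromRoot : ∀ j → Walk root j (level j)
  walkFromRoot j = proj₂ (fromStar (proj₁ sc root j))

  walk-level : ∀ {i j L} → Walk i j L → (level i + L) % c ≡ level j % c
  walk-level {i} {j} {L} w =
    let b , back = fromStar (proj₁ sc j root) in
    ∣+⇒%≡ (subst (c ∣_) (shape (level i) L b) (closedWalk-divisible ((walkFromRoot i ++ᵂ w) ++ᵂ back)))
           (subst (c ∣_) (+-comm b (level j)) (closedWalk-divisible (walkFromRoot j ++ᵂ back)))
    where
    shape : ∀ x L b → b + (L + x) ≡ x + L + b
    shape x L b = trans (+-comm b (L + x)) (cong (_+ b) (+-comm L x))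

  walk-level-∣ : ∀ {M i j L} .{{_ : NonZero M}} → M ∣ c → Walk i j L → (level i + L) % M ≡ level j % M
  walk-level-∣ {M} M∣c w = %-∣ M M∣c (walk-level w)

  walkInto : ∀ L j → ∃ λ i → Walk i j L
  walkInto zero    j = j , []
  walkInto (suc L) j = let k , k∈ = isC j ; i , w = walkInto L k in i , w ∷ʳ k∈

  walkOutOf : ∀ L i → ∃ λ j → Walk i j L
  walkOutOf zero    i = i , []
  walkOutOf (suc L) i = let j , w = walkOutOf L i ; k , e = outEdge j in k , w ∷ʳ e
    where
    outEdge : ∀ j → ∃ λ k → Edge deps j k
    outEdge j = let _ , w = fromStar (proj₁ sc j root) ; _ , e = proj₂ (proj₂ sc) in firstEdge (w ∷ʳ e)

  vertexAtLevel : ℕ → Fin n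
  vertexAtLevel a = proj₁ (walkOutOf a root)

  level-vertexAtLevel : ∀ {M} .{{_ : NonZero M}} → M ∣ c → ∀ a → level (vertexAtLevel a) % M ≡ a % M
  level-vertexAtLevel M∣c a =
    trans (sym (walk-level-∣ M∣c (proj₂ (walkOutOf a root)))) (%-∣ _ M∣c (%-remove-+ˡ a (closedWalk-divisible (walkFromRoot root))))

  LevelInvariant : (M : ℕ) .{{_ : NonZero M}} → Vec Bool n → Set
  LevelInvariant M u = ∀ i j → level i % M ≡ level j % M → lookup u i ≡ lookup u j

  module _ {M : ℕ} .{{_ : NonZero M}} (M∣c : M ∣ c) where

    fixedBy⇒levelInvariant : ∀ {u} → FixedBy M u → LevelInvariant M u
    fixedBy⇒levelInvariant {u} fixed i j same = ≡false⇔⇒≡ (false→false i j same) (false→false j i (sym same))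
      where
      false→false : ∀ i j → level i % M ≡ level j % M → lookup u i ≡ false → lookup u j ≡ false
      false→false i j same =
        let L , w = fromStar (proj₁ sc i j) in
        fixedBy-walk u fixed w ([m+n]%d≡m%d⇒d∣n (level i) L M (trans (walk-level-∣ M∣c w) (sym same)))

    levelInvariant⇒fixedBy : ∀ {u} → LevelInvariant M u → FixedBy M u
    levelInvariant⇒fixedBy {u} invariant = lookup-ext _ _ λ j → ≡false⇔⇒≡ (⇒false j) (⇐false j)
      where
      sameLevel : ∀ {i j} → Walk i j M → level i % M ≡ level j % M
      sameLevel {i} w = trans (sym ([m+n]%n≡m%n (level i) M)) (walk-level-∣ M∣c w)
      ⇒false : ∀ j → lookup (iter deps M u) j ≡ false → lookup u j ≡ false
      ⇒false j uj = let i , w , ui = iter-false⇒walk M u uj in trans (sym (invariant i j (sameLevel w))) ui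
      ⇐false : ∀ j → lookup u j ≡ false → lookup (iter deps M u) j ≡ false
      ⇐false j uj = let i , w = walkInto M j in walk-false u w (trans (invariant i j (sameLevel w)) uj)

    spread : Vec Bool M → Vec Bool n
    spread g = tabulate (λ i → lookup g (level i mod M))

    sample : Vec Bool n → Vec Bool M
    sample u = tabulate (λ a → lookup u (vertexAtLevel (toℕ a)))

    lookup-spread : ∀ g i → lookup (spread g) i ≡ lookup g (level i mod M)
    lookup-spread g = lookup∘tabulate _

    lookup-sample : ∀ u a → lookup (sample u) a ≡ lookup u (vertexAtLevel (toℕ a))
    lookup-sample u = lookup∘tabulate _

    sample∘spread : ∀ g → sample (spread g) ≡ g
    sample∘spread g = lookup-ext _ _ λ a → begin
      lookup (sample (spread g)) a                    ≡⟨ lookup-sample (spread g) a ⟩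
      lookup (spread g) (vertexAtLevel (toℕ a))       ≡⟨ lookup-spread g _ ⟩
      lookup g (level (vertexAtLevel (toℕ a)) mod M)  ≡⟨ cong (lookup g) (toℕ-injective (levelMod a)) ⟩
      lookup g a                                      ∎
      where
      open ≡-Reasoning
      levelMod : ∀ a → toℕ (level (vertexAtLevel (toℕ a)) mod M) ≡ toℕ a
      levelMod a = trans (toℕ-fromℕ< _) (trans (level-vertexAtLevel M∣c (toℕ a)) (m<n⇒m%n≡m (toℕ<n a)))

    spread-injective : Injective _≡_ _≡_ spread
    spread-injective {g} {h} eq = trans (sym (sample∘spread g)) (trans (cong sample eq) (sample∘spread h))

    spread-levelInvariant : ∀ g → LevelInvariant M (spread g)
    spread-levelInvariant g i j same = begin
      lookup (spread g) i       ≡⟨ lookup-spread g i ⟩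
      lookup g (level i mod M)  ≡⟨ cong (lookup g) (toℕ-injective (trans (toℕ-fromℕ< _) (trans same (sym (toℕ-fromℕ< _))))) ⟩
      lookup g (level j mod M)  ≡⟨ lookup-spread g j ⟨
      lookup (spread g) j       ∎
      where open ≡-Reasoning

    spread∘sample : ∀ {u} → LevelInvariant M u → spread (sample u) ≡ u
    spread∘sample {u} invariant = lookup-ext _ _ λ i → begin
      lookup (spread (sample u)) i                    ≡⟨ lookup-spread (sample u) i ⟩
      lookup (sample u) (level i mod M)               ≡⟨ lookup-sample u _ ⟩
      lookup u (vertexAtLevel (toℕ (level i mod M)))  ≡⟨ invariant _ i (sameLevel i) ⟩
      lookup u i                                      ∎
      where
      open ≡-Reasoning
      sameLevel : ∀ i → level (vertexAtLevel (toℕ (level i mod M))) % M ≡ level i % M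
      sameLevel i = trans (level-vertexAtLevel M∣c _) (trans (cong (_% M) (toℕ-fromℕ< _)) (m%n%n≡m%n (level i) M))

    -- A level-invariant state is determined by its values on the M levels.
    fixedBy-hasCardinality : HasCardinality (FixedBy M) (2 ^ M)
    fixedBy-hasCardinality = vecs-hasCardinality spread spread-injective λ u → mk⇔
      (λ fixed → sample u , spread∘sample (fixedBy⇒levelInvariant fixed))
      (λ { (g , refl) → levelInvariant⇒fixedBy (spread-levelInvariant g) })

-- Loop number 1

module Aperiodic {n : ℕ} (deps : Network n) (sc : StronglyConnected deps) (loop : IsLoopNumber deps 1) where

  open Dynamics deps

  module _ (t′ : ℕ) where

    private
      t = suc t′

    ClosedWalkMod : Fin n → ℕ → Set
    ClosedWalkMod j x = ∃ λ L → Walk j j L × L % t ≡ x % t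

    -- Go round the cycle once and then around j → i → j so often that the detour vanishes mod t.
    cycle⇒closedWalkMod : ∀ j {len} → SimpleCycle deps len → ClosedWalkMod j len
    cycle⇒closedWalkMod j {len} cycle =
      let i , C = simpleCycle⇒closedWalk cycle
          a , to = fromStar (proj₁ sc j i)
          b , back = fromStar (proj₁ sc i j)
      in _ , ((to ++ᵂ C) ++ᵂ back) ++ᵂ replicateᵂ t′ (to ++ᵂ back) ,
         trans (cong (_% t) (shape t′ len a b)) ([m+kn]%n≡m%n len (b + a) t)
      where
      shape : ∀ t′ len a b → t′ * (b + a) + (b + (len + a)) ≡ len + (b + a) * suc t′
      shape = solve-∀

    -- With d + y l = x g, the length x La + (t - 1) y Lb is congruent to d + t y l.
    combine : ∀ {La Lb g l d} x y → La % t ≡ g % t → Lb % t ≡ l % t → d + y * l ≡ x * g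
            → (t′ * y * Lb + x * La) % t ≡ d % t
    combine {La} {Lb} {g} {l} {d} x y La≡g Lb≡l eq = begin
      (t′ * y * Lb + x * La) % t
        ≡⟨ %-cong-+ {a = t′ * y * Lb} {b = t′ * y * l} {c = x * La} {d = x * g} (%-cong-*ˡ (t′ * y) Lb≡l) (%-cong-*ˡ x La≡g) ⟩
      (t′ * y * l + x * g) % t      ≡⟨ cong (λ z → (t′ * y * l + z) % t) eq ⟨
      (t′ * y * l + (d + y * l)) % t ≡⟨ cong (_% t) (shape t′ y l d) ⟩
      (d + y * l * t) % t           ≡⟨ [m+kn]%n≡m%n d (y * l) t ⟩
      d % t                         ∎
      where
      open ≡-Reasoning
      shape : ∀ t′ y l d → t′ * y * l + (d + y * l) ≡ d + y * l * suc t′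
      shape = solve-∀

    closedWalkMod-gcd : ∀ {j g l} → ClosedWalkMod j g → ClosedWalkMod j l → ClosedWalkMod j (gcd g l)
    closedWalkMod-gcd {j} {g} {l} (La , Ca , La≡g) (Lb , Cb , Lb≡l) with Bézout.identity (gcd-GCD g l)
    ... | Bézout.+- x y eq = _ , replicateᵂ x Ca ++ᵂ replicateᵂ (t′ * y) Cb , combine x y La≡g Lb≡l eq
    ... | Bézout.-+ x y eq = _ , replicateᵂ y Cb ++ᵂ replicateᵂ (t′ * x) Ca , combine y x Lb≡l La≡g eq

    -- Descent on g through gcd's with cycle lengths; it stops once g divides every cycle, i.e. g = 1.
    closedWalkMod-1 : ∀ j g .{{_ : NonZero g}} → Acc _<_ g → ClosedWalkMod j g → DoubleNegation (ClosedWalkMod j 1)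
    closedWalkMod-1 j g (acc smaller) walk = ¬¬-excluded-middle >>= byCycle
      where
      byCycle : Dec (∃ λ len → SimpleCycle deps len × ¬ g ∣ len) → DoubleNegation (ClosedWalkMod j 1)
      byCycle (no none) = pure (subst (ClosedWalkMod j) (∣1⇒≡1 (proj₂ loop g g∣cycles)) walk)
        where
        g∣cycles : ∀ len → SimpleCycle deps len → g ∣ len
        g∣cycles len cycle = decidable-stable (g ∣? len) (λ g∤len → none (len , cycle , g∤len))
      byCycle (yes (len , cycle , g∤len)) =
        closedWalkMod-1 j (gcd g len) {{d≢0}} (smaller d<g) (closedWalkMod-gcd {g = g} {l = len} walk (cycle⇒closedWalkMod j cycle))
        where
        d≢0 : NonZero (gcd g len)
        d≢0 = ≢-nonZero (gcd[m,n]≢0 g len (inj₁ (≢-nonZero⁻¹ g)))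
        d<g : gcd g len < g
        d<g = ≤∧≢⇒< (∣⇒≤ (gcd[m,n]∣m g len)) (λ d≡g → g∤len (subst (_∣ len) d≡g (gcd[m,n]∣n g len)))

    walk-divisible : ∀ i j → DoubleNegation (∃ λ L → Walk i j L × t ∣ L)
    walk-divisible i j = closedWalkMod-1 j t (<-wellFounded t) (0 , [] , sym (n%n≡0 t)) >>= λ (L , C , L≡1) →
      let a , to = fromStar (proj₁ sc i j) in
      pure (_ , to ++ᵂ replicateᵂ (t′ * a) C , m%n≡0⇒n∣m _ t (begin
        (t′ * a * L + a) % t      ≡⟨ %-cong-+ {a = t′ * a * L} {b = t′ * a * 1} {c = a} {d = a} (%-cong-*ˡ (t′ * a) L≡1) refl ⟩
        (t′ * a * 1 + a) % t      ≡⟨ cong (_% t) (shape t′ a) ⟩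
        (a * t) % t               ≡⟨ m*n%n≡0 a t ⟩
        0                         ∎))
      where
      open ≡-Reasoning
      shape : ∀ t′ a → t′ * a * 1 + a ≡ a * suc t′
      shape = solve-∀

    fixedBy-false-spreads : ∀ {u} → FixedBy t u → ∀ i j → lookup u i ≡ false → lookup u j ≡ false
    fixedBy-false-spreads {u} fixed i j ui = decidable-stable (lookup u j Bool.≟ false) (walk-divisible i j >>= λ (L , w , t∣L) →
      pure (fixedBy-walk u fixed w t∣L ui))

  period⇒constant : ∀ {u t} → HasPeriod deps u t → u ≡ replicate n false ⊎ u ≡ replicate n true
  period⇒constant {u} {suc t′} (_ , fixed , _) =
    false-spreads⇒constant u (proj₁ (proj₂ sc)) (fixedBy-false-spreads t′ fixed)

  aperiodic-theorem : IsConjunctive deps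
    → IsFixedPoint deps (replicate n false) × IsFixedPoint deps (replicate n true)
      × (∀ u t → HasPeriod deps u t → t ≡ 1 × (u ≡ replicate n false ⊎ u ≡ replicate n true))
  aperiodic-theorem isC = false-isFixedPoint isC , true-isFixedPoint , λ u t period →
    let constant = period⇒constant period in
    fixedPoint-period (constant⇒fixed constant) period , constant
    where
    constant⇒fixed : ∀ {u} → u ≡ replicate n false ⊎ u ≡ replicate n true → IsFixedPoint deps u
    constant⇒fixed (inj₁ refl) = false-isFixedPoint isC
    constant⇒fixed (inj₂ refl) = true-isFixedPoint

-- Points of exact period

module PeriodCount {n : ℕ} (deps : Network n) (isC : IsConjunctive deps) (sc : StronglyConnected deps)
  (c : ℕ) .{{_ : NonZero c}} (c∣cycles : ∀ len → SimpleCycle deps len → c ∣ len) where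

  open Dynamics deps
  open Levels deps isC sc c c∣cycles

  fixedBy? : ∀ M → Decidable (FixedBy M)
  fixedBy? M u = ≡-dec Bool._≟_ (iter deps M u) u

  count-fixedBy : ∀ M .{{_ : NonZero M}} → M ∣ c → count (fixedBy? M) ≡ 2 ^ M
  count-fixedBy M M∣c = hasCardinality-unique (count-hasCardinality (fixedBy? M)) (fixedBy-hasCardinality M∣c)

  ExactlyFixed : ∀ r → ℕ → (p k : Fin r → ℕ) → Vec Bool n → Set
  ExactlyFixed r B p k u = FixedBy (B * prodPow r p k) u × (∀ j → ¬ FixedBy (B * prodPow r p (lowerAt k j)) u)

  exactlyFixed? : ∀ r B p k → Decidable (ExactlyFixed r B p k)
  exactlyFixed? r B p k u = fixedBy? (B * prodPow r p k) u ×-dec Fin.all? (λ j → ¬? (fixedBy? (B * prodPow r p (lowerAt k j)) u))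

  module Step {r} (p k : Fin (suc r) → ℕ) (p-prime : ∀ i → Prime (p i)) (p-injective : Injective _≡_ _≡_ p)
    (k>0 : ∀ i → 0 < k i) (B : ℕ) where

    p′ = p ∘ suc
    k′ = k ∘ suc
    B₀ = B * p zero ^ k zero
    B₁ = B * p zero ^ (k zero ∸ 1)
    m′ = prodPow r p′ k′
    m′ⱼ : Fin r → ℕ
    m′ⱼ j = prodPow r p′ (lowerAt k′ j)

    B₀≡B₁*p₀ : ∀ Y → B₀ * Y ≡ B₁ * Y * p zero
    B₀≡B₁*p₀ Y with k zero | k>0 zero
    ... | suc e | _ = shape B (p zero) (p zero ^ e) Y
      where
      shape : ∀ B p q Y → B * (p * q) * Y ≡ B * q * Y * p
      shape = solve-∀

    reassoc : ∀ {X Y u} → FixedBy (B * (X * Y)) u → FixedBy (B * X * Y) u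
    reassoc {X} {Y} = fixedBy-≡ (sym (*-assoc B X Y))

    unassoc : ∀ {X Y u} → FixedBy (B * X * Y) u → FixedBy (B * (X * Y)) u
    unassoc {X} {Y} = fixedBy-≡ (*-assoc B X Y)

    exactlyFixed-suc : ∀ u → (ExactlyFixed r B₀ p′ k′ u × ¬ FixedBy (B₁ * m′) u) ⇔ ExactlyFixed (suc r) B p k u
    exactlyFixed-suc u = mk⇔
      (λ ((fixed , notFixed) , notFixed₀) → unassoc fixed , λ { zero → notFixed₀ ∘ reassoc ; (suc j) → notFixed j ∘ reassoc })
      (λ (fixed , notFixed) → (reassoc fixed , λ j → notFixed (suc j) ∘ unassoc) , notFixed zero ∘ unassoc)

    exactlyFixed-lower : ∀ u → (ExactlyFixed r B₀ p′ k′ u × FixedBy (B₁ * m′) u) ⇔ ExactlyFixed r B₁ p′ k′ u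
    exactlyFixed-lower u = mk⇔
      (λ ((_ , notFixed₀) , fixed₁) → fixed₁ , λ j fixedⱼ → notFixed₀ j (fixedBy-∣ (B₁∣B₀ (m′ⱼ j)) fixedⱼ))
      (λ (fixed₁ , notFixed₁) →
        (fixedBy-∣ (B₁∣B₀ m′) fixed₁ , λ j fixedⱼ → notFixed₁ j (lowered j fixedⱼ fixed₁)) , fixed₁)
      where
      B₁∣B₀ : ∀ Y → B₁ * Y ∣ B₀ * Y
      B₁∣B₀ Y = divides (p zero) (trans (B₀≡B₁*p₀ Y) (*-comm (B₁ * Y) (p zero)))
      -- B₀ m′ⱼ = (B₁ m′ⱼ) p₀ and B₁ m′ = (B₁ m′ⱼ) p′ⱼ with p₀ ≠ p′ⱼ
      lowered : ∀ j → FixedBy (B₀ * m′ⱼ j) u → FixedBy (B₁ * m′) u → FixedBy (B₁ * m′ⱼ j) u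
      lowered j fixed₀ fixed₁ = fixedBy-distinctPrimes {B₁ * m′ⱼ j} (p-prime zero) (p-prime (suc j)) (Fin.0≢1+n ∘ p-injective)
        (fixedBy-≡ (B₀≡B₁*p₀ (m′ⱼ j)) fixed₀)
        (fixedBy-≡ (sym (trans (*-assoc B₁ (m′ⱼ j) (p′ j)) (cong (B₁ *_) (trans (*-comm (m′ⱼ j) (p′ j))
          (prodPow-lower r p′ k′ (k>0 ∘ suc) j))))) fixed₁)

    count-split-suc : count (exactlyFixed? r B₀ p′ k′) ≡ count (exactlyFixed? r B₁ p′ k′) + count (exactlyFixed? (suc r) B p k)
    count-split-suc = trans (count-split (exactlyFixed? r B₀ p′ k′) (fixedBy? (B₁ * m′))) (cong₂ _+_
      (count-cong (exactlyFixed? r B₀ p′ k′ ∩? fixedBy? (B₁ * m′)) _ exactlyFixed-lower)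
      (count-cong (exactlyFixed? r B₀ p′ k′ ∩? ∁? (fixedBy? (B₁ * m′))) _ exactlyFixed-suc))

  count-exactlyFixed : ∀ r (p k : Fin r → ℕ) → (∀ i → Prime (p i)) → Injective _≡_ _≡_ p → (∀ i → 0 < k i)
    → ∀ B → 0 < B → B * prodPow r p k ∣ c → + count (exactlyFixed? r B p k) ≡ scaledPeriodFormula r B p k
  count-exactlyFixed zero p k _ _ _ B B>0 Bm∣c = begin
    + count (exactlyFixed? 0 B p k) ≡⟨ cong +_ (count-cong _ (fixedBy? (B * 1)) (λ u → mk⇔ proj₁ (_, λ ()))) ⟩
    + count (fixedBy? (B * 1))      ≡⟨ cong +_ (count-fixedBy (B * 1) {{>-nonZero (*-mono-≤ B>0 (≤-refl {1}))}} Bm∣c) ⟩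
    + 2 ^ (B * 1)                   ≡⟨ ℤ.*-identityˡ _ ⟨
    scaledPeriodFormula 0 B p k                   ∎
    where open ≡-Reasoning
  count-exactlyFixed (suc r) p k p-prime p-injective k>0 B B>0 Bm∣c = begin
    + count (exactlyFixed? (suc r) B p k)
      ≡⟨ +[m+n]-+m≡+n (count (exactlyFixed? r B₁ p′ k′)) _ ⟨
    + (count (exactlyFixed? r B₁ p′ k′) + count (exactlyFixed? (suc r) B p k)) -ℤ + count (exactlyFixed? r B₁ p′ k′)
      ≡⟨ cong (λ N → + N -ℤ + count (exactlyFixed? r B₁ p′ k′)) count-split-suc ⟨
    + count (exactlyFixed? r B₀ p′ k′) -ℤ + count (exactlyFixed? r B₁ p′ k′)
      ≡⟨ cong₂ _-ℤ_ (induction B₀ B₀>0 B₀m′∣c) (induction B₁ B₁>0 B₁m′∣c) ⟩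
    scaledPeriodFormula r B₀ p′ k′ -ℤ scaledPeriodFormula r B₁ p′ k′
      ≡⟨ scaledPeriodFormula-suc r B p k ⟨
    scaledPeriodFormula (suc r) B p k ∎
    where
    open ≡-Reasoning
    open Step p k p-prime p-injective k>0 B
    induction : ∀ B′ → 0 < B′ → B′ * m′ ∣ c → + count (exactlyFixed? r B′ p′ k′) ≡ scaledPeriodFormula r B′ p′ k′
    induction = count-exactlyFixed r p′ k′ (p-prime ∘ suc) (Fin.suc-injective ∘ p-injective) (k>0 ∘ suc)
    p₀>0 : 0 < p zero
    p₀>0 = prime⇒>0 (p-prime zero)
    B₀>0 : 0 < B₀
    B₀>0 = *-mono-≤ B>0 (m^n>0 (p zero) {{>-nonZero p₀>0}} (k zero))
    B₁>0 : 0 < B₁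
    B₁>0 = *-mono-≤ B>0 (m^n>0 (p zero) {{>-nonZero p₀>0}} (k zero ∸ 1))
    B₀m′∣c : B₀ * m′ ∣ c
    B₀m′∣c = subst (_∣ c) (sym (*-assoc B _ m′)) Bm∣c
    B₁m′∣c : B₁ * m′ ∣ c
    B₁m′∣c = ∣-trans (divides (p zero) (trans (B₀≡B₁*p₀ m′) (*-comm (B₁ * m′) (p zero)))) B₀m′∣c

  exactlyFixed⇔period : ∀ r (p k : Fin r → ℕ) → (∀ i → Prime (p i)) → (∀ i → 0 < k i)
    → ∀ u → ExactlyFixed r 1 p k u ⇔ HasPeriod deps u (prodPow r p k)
  exactlyFixed⇔period r p k p-prime k>0 u = mk⇔
    (λ (fixed , notFixed) → let fixed′ = fixedBy-≡ (*-identityˡ m) fixed in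
       m>0 , fixed′ , λ s s>0 s<m fixedₛ →
         let j , gcd∣mⱼ = properDivisor∣prodPow-lower r p k p-prime k>0 (gcd[m,n]∣n s m) (gcd≢m s>0 s<m) in
         notFixed j (fixedBy-≡ (sym (*-identityˡ (mⱼ j))) (fixedBy-∣ gcd∣mⱼ (fixedBy-gcd {s} {m} fixedₛ fixed′))))
    (λ (_ , fixed , minimal) → fixedBy-≡ (sym (*-identityˡ m)) fixed ,
       λ j fixedⱼ → minimal (mⱼ j) (mⱼ>0 j) (mⱼ<m j) (fixedBy-≡ (*-identityˡ (mⱼ j)) fixedⱼ))
    where
    m = prodPow r p k
    mⱼ : Fin r → ℕ
    mⱼ j = prodPow r p (lowerAt k j)
    p>0 : ∀ i → 0 < p i
    p>0 i = prime⇒>0 (p-prime i)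
    m>0 : 0 < m
    m>0 = prodPow-pos r p k p>0
    mⱼ>0 : ∀ j → 0 < mⱼ j
    mⱼ>0 j = prodPow-pos r p (lowerAt k j) p>0
    mⱼ<m : ∀ j → mⱼ j < m
    mⱼ<m j = subst (mⱼ j <_) (trans (*-comm (mⱼ j) (p j)) (prodPow-lower r p k k>0 j))
      (m<m*n (mⱼ j) (p j) {{>-nonZero (mⱼ>0 j)}} (prime⇒>1 (p-prime j)))
    gcd≢m : ∀ {s} → 0 < s → s < m → gcd s m ≢ m
    gcd≢m {s} s>0 s<m = <⇒≢ (≤-<-trans (∣⇒≤ {{>-nonZero s>0}} (gcd[m,n]∣m s m)) s<m)

periodic-theorem : ∀ {n} (deps : Network n) → IsConjunctive deps → StronglyConnected deps
  → ∀ c → IsLoopNumber deps c → 1 < c → ∀ m → m ∣ c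
  → ∀ r (p k : Fin r → ℕ) → (∀ j → Prime (p j)) → Injective _≡_ _≡_ p → (∀ j → 1 ≤ k j)
  → m ≡ prodFin r (λ j → p j ^ k j)
  → Σ ℕ λ N → HasCardinality (λ u → HasPeriod deps u m) N × (+ N ≡ periodFormula r p k)
periodic-theorem deps isC sc c loop 1<c m m∣c r p k p-prime p-injective k>0 refl =
  count (exactlyFixed? r 1 p k) ,
  hasCardinality-⇔ (exactlyFixed⇔period r p k p-prime k>0) (count-hasCardinality _) ,
  trans (count-exactlyFixed r p k p-prime p-injective k>0 1 ≤-refl (subst (_∣ c) (sym (*-identityˡ m)) m∣c))
        (scaledPeriodFormula-1 r p k)
  where
  instance
    c≢0 : NonZero c
    c≢0 = >-nonZero (<-trans (s≤s z≤n) 1<c)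
  open PeriodCount deps isC sc c (proj₁ loop)

mainTheorem8 : ∀ (n : ℕ) (deps : Network n) → IsConjunctive deps
    → StronglyConnected deps → ∀ (c : ℕ) → IsLoopNumber deps c
    → (c ≡ 1 → IsFixedPoint deps (replicate n false) × IsFixedPoint deps (replicate n true)
         × (∀ (u : Vec Bool n) (t : ℕ) → HasPeriod deps u t
              → t ≡ 1 × (u ≡ replicate n false ⊎ u ≡ replicate n true)))
    × (1 < c → ∀ (m : ℕ) → m ∣ c → ∀ (r : ℕ) (p k : Fin r → ℕ)
         → (∀ j → Prime (p j)) → Injective _≡_ _≡_ p → (∀ j → 1 ≤ k j)
         → m ≡ prodFin r (λ j → p j ^ k j)
         → Σ ℕ (λ N → HasCardinality (λ u → HasPeriod deps u m) N
                        × (+ N ≡ periodFormula r p k)))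
mainTheorem8 n deps isC sc c loop =
  (λ { refl → Aperiodic.aperiodic-theorem deps sc loop isC }) ,
  periodic-theorem deps isC sc c loop
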